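{- Assume propositional extensionality. If there is a left-cancellable map $f:\mathcal{U}\to\mathcal{U}$ with $f(\mathbf{1})=\mathbf{0}$, then double-negation elimination holds.
   Context: Work in intensional Martin-Löf type theory with $\Pi$-, $\Sigma$-, identity, finite types and natural numbers, and a universe $\mathcal{U}$ closed under these. $\neg X$ is $X\to\mathbf{0}$. A type $P$ is a proposition ($\mathrm{isProp}(P)$) if any two elements are equal. Propositional extensionality: logically equivalent propositions are equal. DNE: $\prod_{P:\mathcal{U}}\mathrm{isProp}(P)\to\neg\neg P\to P$. A map $f$ is left-cancellable if $f(X)=f(Y)$ implies $X=Y$ for all $X,Y$. -}

module Defs where

open import Data.Empty using (⊥)
open import Data.Unit using (⊤)
open import Relation.Nullary using (¬_)
open import Relation.Binary.PropositionalEquality using (_≡_)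
open import Function.Bundles using (_⇔_)

isProp : Set → Set
isProp P = (x y : P) → x ≡ y

PropExt : Set₁
PropExt = (P Q : Set) → isProp P → isProp Q → (P ⇔ Q) → P ≡ Q

DNE : Set₁
DNE = (P : Set) → isProp P → ¬ ¬ P → P

LeftCancellable : (Set → Set) → Set₁
LeftCancellable f = {X Y : Set} → f X ≡ f Y → X ≡ Y

-- If P holds then P = 𝟙, so f P = 𝟘; hence f P → ¬ P, and ¬¬P makes f P empty.
-- Then f P = 𝟘 = f 𝟙, and left-cancellability gives P = 𝟙, so P holds.
module Submission where

open import Defs
open import Data.Empty using (⊥; ⊥-elim)
open import Data.Unit using (⊤; tt)
open import Data.Product using (Σ; _×_; _,_)
open import Relation.Nullary using (¬_)
open import Relation.Binary.PropositionalEquality using (_≡_; refl; subst; sym; trans; cong)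
open import Function.Base using (id)
open import Function.Bundles using (mk⇔)

⊤-isProp : isProp ⊤
⊤-isProp tt tt = refl

¬⇒isProp : {X : Set} → ¬ X → isProp X
¬⇒isProp ¬x x = ⊥-elim (¬x x)

transport : {X Y : Set} → X ≡ Y → X → Y
transport = subst id

inhabited-prop≡⊤ : PropExt → {P : Set} → isProp P → P → P ≡ ⊤
inhabited-prop≡⊤ pe {P} isPropP p = pe P ⊤ isPropP ⊤-isProp (mk⇔ (λ _ → tt) (λ _ → p))

empty≡⊥ : PropExt → {X : Set} → ¬ X → X ≡ ⊥
empty≡⊥ pe {X} ¬x = pe X ⊥ (¬⇒isProp ¬x) (¬⇒isProp id) (mk⇔ ¬x ⊥-elim)

image-refutes : PropExt → (f : Set → Set) → f ⊤ ≡ ⊥ →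
                {P : Set} → isProp P → f P → ¬ P
image-refutes pe f f⊤≡⊥ isPropP y p =
  transport (trans (cong f (inhabited-prop≡⊤ pe isPropP p)) f⊤≡⊥) y

theorem3p7 : PropExt → Σ (Set → Set) (λ f → LeftCancellable f × (f ⊤ ≡ ⊥)) → DNE
theorem3p7 pe (f , cancel , f⊤≡⊥) P isPropP ¬¬p = transport (sym P≡⊤) tt
  where
  fP≡⊥ : f P ≡ ⊥
  fP≡⊥ = empty≡⊥ pe (λ y → ¬¬p (image-refutes pe f f⊤≡⊥ isPropP y))

  P≡⊤ : P ≡ ⊤
  P≡⊤ = cancel (trans fP≡⊥ (sym f⊤≡⊥))
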